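{- Let $H$ be a graph of order $n\ge 2$. Then $H$ is a $PCT$-graph (i.e., $H$ is isomorphic to $PCG(T,\pi)$ for some tree $T$ and some $pc$-partition $\pi$ of $T$) if and only if $H\cong K_{1,n-1}$.
   Context: All graphs are finite, simple and undirected. A paired dominating set of $G$ is a dominating set $S$ of $G$ such that $G[S]$ has a perfect matching. Two disjoint sets $V_1,V_2\subseteq V(G)$ form a paired coalition ($pc$-partners) if neither is a paired dominating set but $V_1\cup V_2$ is. A $pc$-partition of $G$ is a partition $\pi=\{V_1,\dots,V_k\}$ of $V(G)$ into nonempty sets, none a paired dominating set, such that every $V_i$ forms a paired coalition with some other $V_j\in\pi$. The paired coalition graph $PCG(G,\pi)$ has vertex set $\{v_1,\dots,v_k\}$ with $v_iv_j$ an edge iff $V_i,V_j$ form a paired coalition. -}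

module Defs where

open import Data.Nat using (ℕ; zero; suc)
open import Data.Fin using (Fin; zero; suc; _≟_)
open import Data.Bool using (Bool; true; false; _∨_; _xor_)
open import Data.Bool.Properties using (xor-comm; xor-same)
open import Data.List using (List; []; _∷_; _++_; [_]; length)
open import Data.List.Relation.Unary.Linked using (Linked)
open import Data.List.Relation.Unary.Unique.Propositional using (Unique)
open import Data.Product using (Σ; _×_; _,_)
open import Data.Sum using (_⊎_)
open import Relation.Nullary using (¬_; does)
open import Relation.Binary.PropositionalEquality using (_≡_; _≢_)
open import Function.Bundles using (_⇔_; _↔_; Inverse)
open import Data.Nat using (_≤_)

record Graph (n : ℕ) : Set where
  field
    adj    : Fin n → Fin n → Bool
    sym    : ∀ u v → adj u v ≡ adj v u
    irrefl : ∀ v → adj v v ≡ false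

open Graph public

Edge : ∀ {n} → Graph n → Fin n → Fin n → Set
Edge G u v = adj G u v ≡ true

data Walk {n} (G : Graph n) : Fin n → Fin n → Set where
  here : ∀ {v} → Walk G v v
  step : ∀ {u w v} → Edge G u w → Walk G w v → Walk G u v

Connected : ∀ {n} → Graph n → Set
Connected {n} G = ∀ (u v : Fin n) → Walk G u v

-- a cycle x, x₁, …, x_k, x with k ≥ 2 (so length ≥ 3) and pairwise distinct vertices
record Cycle {n} (G : Graph n) : Set where
  field
    start    : Fin n
    rest     : List (Fin n)
    long     : 2 ≤ length rest
    distinct : Unique (start ∷ rest)
    edges    : Linked (Edge G) (start ∷ rest ++ [ start ])

Acyclic : ∀ {n} → Graph n → Set
Acyclic G = ¬ Cycle G

IsTree : ∀ {n} → Graph n → Set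
IsTree G = Connected G × Acyclic G

VSet : ℕ → Set
VSet n = Fin n → Bool

_∈S_ : ∀ {n} → Fin n → VSet n → Set
v ∈S S = S v ≡ true

_∪S_ : ∀ {n} → VSet n → VSet n → VSet n
(S ∪S T) v = S v ∨ T v

Dominating : ∀ {n} → Graph n → VSet n → Set
Dominating {n} G S = ∀ (v : Fin n) → v ∈S S ⊎ Σ (Fin n) (λ u → u ∈S S × Edge G u v)

-- G[S] has a perfect matching, given by a partner function on S
-- (every vertex of S is matched to an adjacent vertex of S, and the matching is an involution)
HasPerfectMatching : ∀ {n} → Graph n → VSet n → Set
HasPerfectMatching {n} G S =
  Σ (Fin n → Fin n) λ m → ∀ v → v ∈S S → (m v ∈S S) × Edge G v (m v) × (m (m v) ≡ v)

IsPDS : ∀ {n} → Graph n → VSet n → Set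
IsPDS G S = Dominating G S × HasPerfectMatching G S

-- partitions of V(G) into k parts, given by a part-assignment p : Fin n → Fin k

Part : ∀ {n k} → (Fin n → Fin k) → Fin k → VSet n
Part p i v = does (p v ≟ i)

PCPartners : ∀ {n k} → Graph n → (Fin n → Fin k) → Fin k → Fin k → Set
PCPartners G p i j =
  i ≢ j × ¬ IsPDS G (Part p i) × ¬ IsPDS G (Part p j) × IsPDS G (Part p i ∪S Part p j)

IsPCPartition : ∀ {n k} → Graph n → (Fin n → Fin k) → Set
IsPCPartition {n} {k} G p =
  (∀ (i : Fin k) → Σ (Fin n) λ v → p v ≡ i) ×
  (∀ (i : Fin k) → ¬ IsPDS G (Part p i)) ×
  (∀ (i : Fin k) → Σ (Fin k) λ j → PCPartners G p i j)

PCGAdj : ∀ {n k} → Graph n → (Fin n → Fin k) → Fin k → Fin k → Set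
PCGAdj G p i j = PCPartners G p i j

_≅Rel_ : ∀ {n k} → Graph n → (Fin k → Fin k → Set) → Set
_≅Rel_ {n} {k} H R =
  Σ (Fin n ↔ Fin k) λ f → ∀ u v → Edge H u v ⇔ R (Inverse.to f u) (Inverse.to f v)

_≅_ : ∀ {n m} → Graph n → Graph m → Set
H ≅ G = H ≅Rel Edge G

IsPCTGraph : ∀ {n} → Graph n → Set
IsPCTGraph {n} H =
  Σ ℕ λ m → Σ (Graph m) λ T → IsTree T ×
    Σ ℕ λ k → Σ (Fin m → Fin k) λ p → IsPCPartition T p × (H ≅Rel PCGAdj T p)

-- the star K_{1,n-1} on Fin n with centre zero
isZero : ∀ {n} → Fin n → Bool
isZero zero    = true
isZero (suc _) = false

star : (n : ℕ) → Graph n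
star n = record
  { adj = λ u v → isZero u xor isZero v
  ; sym = λ u v → xor-comm (isZero u) (isZero v)
  ; irrefl = λ v → xor-same (isZero v) }

-- Every finite forest has a vertex v with at most one neighbour s. Every paired dominating
-- set contains s, since it has to dominate v and, if it contains v, match v to a neighbour.
-- Hence every paired coalition contains the part of s, and since every part has a partner,
-- the paired coalition graph is the star centred at that part. Conversely, the partition of
-- K_{1,n-1} into singletons has K_{1,n-1} as its paired coalition graph: no singleton is a
-- paired dominating set, while the centre together with any leaf is one.
module Submission where

open import Defs
open import Data.Nat using (ℕ; _≤_)
open import Function.Bundles using (_⇔_)

open import Level using (0ℓ)
open import Data.Nat using (zero; suc; z≤n; s≤s; _<_; _+_)
open import Data.Nat.Properties using (<⇒≱; n<1+n; +-suc; +-identityʳ; m≤n+m)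
open import Data.Fin using (Fin; zero; suc; _≟_)
open import Data.Fin.Properties using (any?; injective⇒≤)
open import Data.Fin.Permutation using (transpose)
import Data.Fin.Permutation.Components as Transposition
open import Data.Bool using (true; false; _xor_)
open import Data.Bool.Properties using (∨-comm) renaming (_≟_ to _≟ᵇ_)
open import Data.List using (List; []; _∷_; _++_; [_]; length; lookup)
open import Data.List.Properties using (++-assoc; length-++)
open import Data.List.Relation.Unary.Linked using (Linked; [-]; _∷_)
open import Data.List.Relation.Unary.All using ([]; _∷_)
import Data.List.Relation.Unary.All as All
open import Data.List.Relation.Unary.All.Properties using (¬Any⇒All¬; ++⁻ˡ)
open import Data.List.Relation.Unary.AllPairs using ([]; _∷_)
open import Data.List.Relation.Unary.Unique.Propositional using (Unique)
open import Data.List.Relation.Unary.Any using (here; there)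
open import Data.List.Membership.Propositional using (_∈_)
open import Data.List.Membership.Propositional.Properties using (∈-lookup; ∈-∃++)
import Data.List.Membership.DecPropositional as DecMembership
open import Data.Product using (_×_; _,_; proj₁)
open import Data.Sum using (_⊎_; inj₁; inj₂)
import Data.Sum as Sum
open import Data.Empty using (⊥-elim)
open import Relation.Nullary using (¬_; Dec; does; yes; no; ¬?)
open import Relation.Nullary.Decidable using (dec-true; _×-dec_)
open import Relation.Binary.PropositionalEquality using (_≡_; _≢_; _≗_; refl; trans; cong; subst)
import Relation.Binary.PropositionalEquality as ≡
open import Function using (id; _∘_)
open import Function.Bundles using (_↔_; Inverse; Injection; mk⇔; Equivalence)
open import Function.Definitions using (Injective)
open import Function.Properties.Inverse using (↔⇒↣)
import Function.Properties.Equivalence as ⇔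
import Relation.Binary.Reasoning.Setoid as SetoidReasoning

module ⇔-Reasoning = SetoidReasoning (⇔.⇔-setoid 0ℓ)

private
  variable
    n k : ℕ

true⇒witness : ∀ {A : Set} (a? : Dec A) → does a? ≡ true → A
true⇒witness (yes a) _ = a

∈-Part⇔ : {p : Fin n → Fin k} {i : Fin k} {v : Fin n} → v ∈S Part p i ⇔ p v ≡ i
∈-Part⇔ {p = p} {i} {v} = mk⇔ (true⇒witness (p v ≟ i)) (dec-true (p v ≟ i))

∈-∪⇔ : (S T : VSet n) {v : Fin n} → v ∈S (S ∪S T) ⇔ (v ∈S S ⊎ v ∈S T)
∈-∪⇔ S T {v} with S v
... | true  = mk⇔ (λ _ → inj₁ refl) (λ _ → refl)
... | false = mk⇔ inj₂ Sum.[ (λ ()) , id ]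

Edge-sym : (G : Graph n) {u v : Fin n} → Edge G u v → Edge G v u
Edge-sym G {u} {v} e = trans (Graph.sym G v u) e

Edge⇒≢ : (G : Graph n) {u v : Fin n} → Edge G u v → u ≢ v
Edge⇒≢ G {u} e refl with () ← trans (≡.sym (irrefl G u)) e

IsPDS-resp : {G : Graph n} {S T : VSet n} → S ≗ T → IsPDS G S → IsPDS G T
IsPDS-resp {G = G} {S} {T} S≗T (dominating , m , matched) = dominating′ , m , matched′
  where
  S⊆T : ∀ {v} → v ∈S S → v ∈S T
  S⊆T {v} = trans (≡.sym (S≗T v))

  dominating′ : Dominating G T
  dominating′ v = Sum.map S⊆T (λ (u , u∈S , e) → u , S⊆T u∈S , e) (dominating v)

  matched′ : ∀ v → v ∈S T → (m v ∈S T) × Edge G v (m v) × (m (m v) ≡ v)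
  matched′ v v∈T with matched v (trans (S≗T v) v∈T)
  ... | mv∈S , e , involutive = S⊆T mv∈S , e , involutive

PCPartners-sym : {G : Graph n} {p : Fin n → Fin k} {i j : Fin k} →
                 PCPartners G p i j → PCPartners G p j i
PCPartners-sym {G = G} {p} {i} {j} (i≢j , ¬pdsᵢ , ¬pdsⱼ , pds) =
  i≢j ∘ ≡.sym , ¬pdsⱼ , ¬pdsᵢ , IsPDS-resp {G = G} (λ v → ∨-comm (Part p i v) (Part p j v)) pds

¬IsPDS-singleton : (G : Graph n) (v : Fin n) → ¬ IsPDS G (Part id v)
¬IsPDS-singleton G v (_ , m , matched) with matched v (dec-true (v ≟ v) refl)
... | mv∈S , e , _ = Edge⇒≢ G e (≡.sym (Equivalence.to (∈-Part⇔ {p = id}) mv∈S))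

-- An isolated vertex is recorded with itself as support.
record Pendant (G : Graph n) : Set where
  field
    leaf support     : Fin n
    leaf-adj⇒support : ∀ {u} → Edge G leaf u → u ≡ support

StarAdj : Fin k → Fin k → Fin k → Set
StarAdj c i j = i ≢ j × (i ≡ c ⊎ j ≡ c)

module _ {G : Graph n} (P : Pendant G) where
  open Pendant P

  support∈PDS : {S : VSet n} → IsPDS G S → support ∈S S
  support∈PDS {S} (dominating , m , matched) with dominating leaf
  ... | inj₂ (u , u∈S , e) = subst (_∈S S) (leaf-adj⇒support (Edge-sym G e)) u∈S
  ... | inj₁ leaf∈S with matched leaf leaf∈S
  ...   | m-leaf∈S , e , _ = subst (_∈S S) (leaf-adj⇒support e) m-leaf∈S

  PCPartners⇒support : {p : Fin n → Fin k} {i j : Fin k} →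
                       PCPartners G p i j → i ≡ p support ⊎ j ≡ p support
  PCPartners⇒support {p = p} {i} {j} (_ , _ , _ , pds) =
    Sum.map (≡.sym ∘ Equivalence.to (∈-Part⇔ {p = p})) (≡.sym ∘ Equivalence.to (∈-Part⇔ {p = p}))
            (Equivalence.to (∈-∪⇔ (Part p i) (Part p j)) (support∈PDS pds))

  PCGAdj⇔StarAdj : {p : Fin n → Fin k} → IsPCPartition G p →
                   ∀ i j → PCGAdj G p i j ⇔ StarAdj (p support) i j
  PCGAdj⇔StarAdj {p = p} (_ , _ , partner) i j =
    mk⇔ (λ pc → proj₁ pc , PCPartners⇒support {p = p} pc) star⇒pc
    where
    partnerOfSupport : ∀ {i} → i ≢ p support → PCPartners G p i (p support)
    partnerOfSupport {i} i≢ps with partner i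
    ... | _ , pc with PCPartners⇒support {p = p} pc
    ...   | inj₁ i≡ps = ⊥-elim (i≢ps i≡ps)
    ...   | inj₂ refl = pc

    star⇒pc : StarAdj (p support) i j → PCGAdj G p i j
    star⇒pc (i≢j , inj₁ refl) = PCPartners-sym {G = G} {p = p} (partnerOfSupport (i≢j ∘ ≡.sym))
    star⇒pc (i≢j , inj₂ refl) = partnerOfSupport i≢j

lookup-injective : {A : Set} {xs : List A} → Unique xs → Injective _≡_ _≡_ (lookup xs)
lookup-injective (_ ∷ u)   {zero}  {zero}  _  = refl
lookup-injective (x≢ ∷ _)  {zero}  {suc j} eq = ⊥-elim (All.lookup x≢ (∈-lookup j) eq)
lookup-injective (x≢ ∷ _)  {suc i} {zero}  eq = ⊥-elim (All.lookup x≢ (∈-lookup i) (≡.sym eq))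
lookup-injective (_ ∷ u)   {suc i} {suc j} eq = cong suc (lookup-injective u eq)

Unique⇒length≤ : {xs : List (Fin n)} → Unique xs → length xs ≤ n
Unique⇒length≤ u = injective⇒≤ (lookup-injective u)

Unique-++⁻ˡ : {A : Set} (xs : List A) {ys : List A} → Unique (xs ++ ys) → Unique xs
Unique-++⁻ˡ []       _        = []
Unique-++⁻ˡ (x ∷ xs) (x∉ ∷ u) = ++⁻ˡ xs x∉ ∷ Unique-++⁻ˡ xs u

Linked-close : {A : Set} {R : A → A → Set} (a : A) (xs : List A) {w z : A} {B : List A} →
               Linked R (a ∷ xs ++ w ∷ B) → R w z → Linked R (a ∷ (xs ++ [ w ]) ++ [ z ])
Linked-close a []       (r ∷ _) rwz = r ∷ rwz ∷ [-]
Linked-close a (c ∷ xs) (r ∷ l) rwz = r ∷ Linked-close c xs l rwz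

-- A path is grown as a list x ∷ P, current end x first, until x has no neighbour besides its
-- predecessor (the head of P); a different neighbour already on the path would close a cycle.
module _ (G : Graph n) (acyclic : Acyclic G) where
  open DecMembership (_≟_ {n}) using (_∈?_)

  predecessor : Fin n → List (Fin n) → Fin n
  predecessor x []      = x
  predecessor x (y ∷ _) = y

  backEdge⇒cycle : ∀ {x w} P → Unique (x ∷ P) → Linked (Edge G) (x ∷ P) →
                   Edge G x w → w ≢ predecessor x P → w ∈ P → Cycle G
  backEdge⇒cycle (y ∷ P) _ _ _ w≢y (here w≡y) = ⊥-elim (w≢y w≡y)
  backEdge⇒cycle {x} {w} (y ∷ P) u l e _ (there w∈P) with A , B , refl ← ∈-∃++ w∈P =
    record
      { start    = x
      ; rest     = y ∷ A ++ [ w ]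
      ; long     = s≤s (subst (1 ≤_) (≡.sym (length-++ A)) (m≤n+m 1 (length A)))
      ; distinct = Unique-++⁻ˡ (x ∷ y ∷ A ++ [ w ])
                     (subst Unique (≡.sym (++-assoc (x ∷ y ∷ A) [ w ] B)) u)
      ; edges    = Linked-close x (y ∷ A) l (Edge-sym G e)
      }

  extendPath : (fuel : ℕ) (x : Fin n) (P : List (Fin n)) →
               Unique (x ∷ P) → Linked (Edge G) (x ∷ P) → n < length (x ∷ P) + fuel →
               Pendant G
  extendPath zero x P u _ bound =
    ⊥-elim (<⇒≱ (subst (n <_) (+-identityʳ _) bound) (Unique⇒length≤ u))
  extendPath (suc fuel) x P u l bound
    with any? (λ w → (adj G x w ≟ᵇ true) ×-dec ¬? (w ≟ predecessor x P))
  ... | no noOtherNeighbour = record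
    { leaf = x ; support = predecessor x P ; leaf-adj⇒support = onlyPredecessor }
    where
    onlyPredecessor : ∀ {w} → Edge G x w → w ≡ predecessor x P
    onlyPredecessor {w} e with w ≟ predecessor x P
    ... | yes w≡pred = w≡pred
    ... | no  w≢pred = ⊥-elim (noOtherNeighbour (w , e , w≢pred))
  ... | yes (w , e , w≢pred) with w ∈? P
  ...   | yes w∈P = ⊥-elim (acyclic (backEdge⇒cycle P u l e w≢pred w∈P))
  ...   | no  w∉P = extendPath fuel w (x ∷ P)
                      (((Edge⇒≢ G e ∘ ≡.sym) ∷ ¬Any⇒All¬ P w∉P) ∷ u) (Edge-sym G e ∷ l)
                      (subst (n <_) (+-suc (length (x ∷ P)) fuel) bound)

  acyclic⇒Pendant : Fin n → Pendant G
  acyclic⇒Pendant v = extendPath n v [] ([] ∷ []) [-] (n<1+n n)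

isZero≡does : (u : Fin (suc n)) → isZero u ≡ does (u ≟ zero)
isZero≡does zero    = refl
isZero≡does (suc _) = refl

xor-does⇔StarAdj : {c u v : Fin n} → does (u ≟ c) xor does (v ≟ c) ≡ true ⇔ StarAdj c u v
xor-does⇔StarAdj {c = c} {u} {v} with u ≟ c | v ≟ c
... | yes refl | yes refl = mk⇔ (λ ()) (λ (u≢u , _) → ⊥-elim (u≢u refl))
... | yes refl | no  v≢c  = mk⇔ (λ _ → v≢c ∘ ≡.sym , inj₁ refl) (λ _ → refl)
... | no  u≢c  | yes refl = mk⇔ (λ _ → u≢c , inj₂ refl) (λ _ → refl)
... | no  u≢c  | no  v≢c  = mk⇔ (λ ()) (λ (_ , hit) → ⊥-elim (Sum.[ u≢c , v≢c ] hit))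

star-Edge⇔StarAdj : (u v : Fin (suc n)) → Edge (star (suc n)) u v ⇔ StarAdj zero u v
star-Edge⇔StarAdj u v rewrite isZero≡does u | isZero≡does v = xor-does⇔StarAdj

StarAdj-injective : {f : Fin n → Fin k} → Injective _≡_ _≡_ f →
                    {c u v : Fin n} → StarAdj (f c) (f u) (f v) ⇔ StarAdj c u v
StarAdj-injective {f = f} f-inj = mk⇔
  (λ (fu≢fv , hit) → fu≢fv ∘ cong f , Sum.map f-inj f-inj hit)
  (λ (u≢v , hit) → u≢v ∘ f-inj , Sum.map (cong f) (cong f) hit)

transpose-matchˡ : (i j : Fin n) → Transposition.transpose i j i ≡ j
transpose-matchˡ i j rewrite dec-true (i ≟ i) refl = refl

≅Rel-resp : {H : Graph n} {R R′ : Fin k → Fin k → Set} →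
            (∀ i j → R i j ⇔ R′ i j) → H ≅Rel R → H ≅Rel R′
≅Rel-resp R⇔R′ (f , H⇔R) = f , λ u v →
  ⇔.trans (H⇔R u v) (R⇔R′ _ _)

≅StarAdj⇒≅star : {H : Graph (suc n)} {c : Fin k} → H ≅Rel StarAdj c → H ≅ star (suc n)
≅StarAdj⇒≅star {n} {H = H} {c} (f , H⇔) = τ , λ u v → begin
  Edge H u v                                      ≈⟨ H⇔ u v ⟩
  StarAdj c (to u) (to v)                         ≡⟨ cong (λ a → StarAdj a (to u) (to v))
                                                          (≡.sym (strictlyInverseˡ c)) ⟩
  StarAdj (to c′) (to u) (to v)                   ≈⟨ StarAdj-injective to-injective ⟩
  StarAdj c′ u v                                  ≈⟨ StarAdj-injective τ-injective ⟨
  StarAdj (τ⟨ c′ ⟩) (τ⟨ u ⟩) (τ⟨ v ⟩)             ≡⟨ cong (λ a → StarAdj a τ⟨ u ⟩ τ⟨ v ⟩)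
                                                          (transpose-matchˡ c′ zero) ⟩
  StarAdj zero (τ⟨ u ⟩) (τ⟨ v ⟩)                  ≈⟨ star-Edge⇔StarAdj τ⟨ u ⟩ τ⟨ v ⟩ ⟨
  Edge (star _) (τ⟨ u ⟩) (τ⟨ v ⟩)                 ∎
  where
  open ⇔-Reasoning
  open Inverse f using (to; from; strictlyInverseˡ)
  c′ : Fin (suc n)
  c′ = from c

  τ : Fin (suc n) ↔ Fin (suc n)
  τ = transpose c′ zero

  τ⟨_⟩ : Fin (suc n) → Fin (suc n)
  τ⟨_⟩ = Inverse.to τ

  to-injective : Injective _≡_ _≡_ to
  to-injective = Injection.injective (↔⇒↣ f)

  τ-injective : Injective _≡_ _≡_ τ⟨_⟩
  τ-injective = Injection.injective (↔⇒↣ τ)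

star-isConnected : Connected (star n)
star-isConnected zero    zero    = here
star-isConnected zero    (suc _) = step refl here
star-isConnected (suc _) zero    = step refl here
star-isConnected (suc _) (suc _) = step refl (step refl here)

-- Every edge of a star has exactly one end at the centre.
star-walk₃ : {a b c d : Fin n} → Edge (star n) a b → Edge (star n) b c → Edge (star n) c d →
             a ≡ c ⊎ b ≡ d
star-walk₃ {a = zero}  {zero}          ()
star-walk₃ {a = suc _} {suc _}         ()
star-walk₃ {a = zero}  {suc _} {zero}  _ _ _ = inj₁ refl
star-walk₃ {a = zero}  {suc _} {suc _} _ ()
star-walk₃ {a = suc _} {zero}  {zero}  _ ()
star-walk₃ {a = suc _} {zero}  {suc _} {zero}  _ _ _ = inj₂ refl
star-walk₃ {a = suc _} {zero}  {suc _} {suc _} _ _ ()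

star-isAcyclic : Acyclic (star n)
star-isAcyclic record { rest = [] ; long = () }
star-isAcyclic record { rest = _ ∷ [] ; long = s≤s () }
star-isAcyclic record
  { rest     = _ ∷ _ ∷ []
  ; distinct = (x₀≢x₁ ∷ x₀≢x₂ ∷ _) ∷ _
  ; edges    = e₀₁ ∷ e₁₂ ∷ e₂₀ ∷ _
  } = Sum.[ x₀≢x₂ , x₀≢x₁ ∘ ≡.sym ] (star-walk₃ e₀₁ e₁₂ e₂₀)
star-isAcyclic record
  { rest     = _ ∷ _ ∷ _ ∷ _
  ; distinct = (_ ∷ x₀≢x₂ ∷ _) ∷ (_ ∷ x₁≢x₃ ∷ _) ∷ _
  ; edges    = e₀₁ ∷ e₁₂ ∷ e₂₃ ∷ _
  } = Sum.[ x₀≢x₂ , x₁≢x₃ ] (star-walk₃ e₀₁ e₁₂ e₂₃)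

star-isTree : IsTree (star n)
star-isTree = star-isConnected , star-isAcyclic

centre-leaf-isPDS : (j : Fin n) → IsPDS (star (suc n)) (Part id zero ∪S Part id (suc j))
centre-leaf-isPDS j = dominating , partner , matched
  where
  S : VSet (suc _)
  S = Part id zero ∪S Part id (suc j)

  leaf∈S : suc j ∈S S
  leaf∈S = dec-true (suc j ≟ suc j) refl

  dominating : Dominating (star _) S
  dominating zero    = inj₁ refl
  dominating (suc _) = inj₂ (zero , refl , refl)

  partner : Fin (suc _) → Fin (suc _)
  partner zero    = suc j
  partner (suc _) = zero

  matched : ∀ v → v ∈S S → (partner v ∈S S) × Edge (star _) v (partner v) × (partner (partner v) ≡ v)
  matched zero    _   = leaf∈S , refl , refl
  matched (suc t) v∈S with Equivalence.to (∈-∪⇔ (Part id zero) (Part id (suc j)) {suc t}) v∈S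
  ... | inj₁ ()
  ... | inj₂ v∈leaf = refl , refl , ≡.sym (Equivalence.to (∈-Part⇔ {p = id}) v∈leaf)

centre-leaf-partners : (j : Fin n) → PCPartners (star (suc n)) id zero (suc j)
centre-leaf-partners j =
  (λ ()) , ¬IsPDS-singleton (star _) zero , ¬IsPDS-singleton (star _) (suc j) , centre-leaf-isPDS j

Edge⇒PCPartners : {i j : Fin (suc n)} → Edge (star (suc n)) i j → PCPartners (star (suc n)) id i j
Edge⇒PCPartners {i = zero}  {suc j} _ = centre-leaf-partners j
Edge⇒PCPartners {i = suc i} {zero}  _ = PCPartners-sym {G = star _} {p = id} (centre-leaf-partners i)

star-isPCPartition : IsPCPartition (star (suc (suc n))) id
star-isPCPartition = (λ i → i , refl) , ¬IsPDS-singleton (star _) , λ where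
  zero    → suc zero , Edge⇒PCPartners refl
  (suc _) → zero     , Edge⇒PCPartners refl

star-Edge⇔PCGAdj : (i j : Fin (suc (suc n))) →
                   Edge (star (suc (suc n))) i j ⇔ PCGAdj (star (suc (suc n))) id i j
star-Edge⇔PCGAdj i j = mk⇔ Edge⇒PCPartners
  (Equivalence.from (star-Edge⇔StarAdj i j) ∘ Equivalence.to (PCGAdj⇔StarAdj leafOne star-isPCPartition i j))
  where
  leaf-adj⇒centre : ∀ {u} → Edge (star (suc (suc _))) (suc zero) u → u ≡ zero
  leaf-adj⇒centre {zero} _ = refl

  leafOne : Pendant (star _)
  leafOne = record { leaf = suc zero ; support = zero ; leaf-adj⇒support = leaf-adj⇒centre }

mainTheorem5 : (n : ℕ) → 2 ≤ n → (H : Graph n) → IsPCTGraph H ⇔ (H ≅ star n)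
mainTheorem5 (suc (suc n)) (s≤s (s≤s z≤n)) H = mk⇔ pct⇒star star⇒pct
  where
  pct⇒star : IsPCTGraph H → H ≅ star _
  pct⇒star (_ , T , (_ , acyclic) , _ , p , pcp@(p-onto , _) , H≅PCG@(f , _)) =
    ≅StarAdj⇒≅star {H = H} (≅Rel-resp {H = H} (PCGAdj⇔StarAdj pendant pcp) H≅PCG)
    where
    pendant : Pendant T
    pendant = acyclic⇒Pendant T acyclic (proj₁ (p-onto (Inverse.to f zero)))

  star⇒pct : H ≅ star _ → IsPCTGraph H
  star⇒pct H≅star = _ , star _ , star-isTree , _ , id , star-isPCPartition ,
                    ≅Rel-resp {H = H} star-Edge⇔PCGAdj H≅star
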